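{- Let $\mathcal H$ be a family of graphs. There exists a constant $c=c(\mathcal H)$ such that every $\mathcal H$-free graph $G$ has fewer than $c$ vertices of degree at least $2$ if and only if \[\mathcal H\le\{K_n,\ nP_3,\ nK_3,\ K_{1,n}^*,\ K_{2,n},\ K_2+nK_1,\ K_1+nK_2\}\] for some positive integer $n$.
   Context: All graphs are finite, simple and undirected. For graphs $H_1,H_2$, write $H_1\prec H_2$ if $H_2$ contains an induced subgraph isomorphic to $H_1$. A graph $G$ is $\mathcal H$-free if no $H\in\mathcal H$ satisfies $H\prec G$. For families, $\mathcal H_1\le\mathcal H_2$ means for every $H_2\in\mathcal H_2$ there is $H_1\in\mathcal H_1$ with $H_1\prec H_2$. $K_n$, $P_n$ are the complete graph and path on $n$ vertices; $K_{s,t}$ the complete bipartite graph; $nG$ the disjoint union of $n$ copies of $G$ ($nK_1$ is the edgeless graph on $n$ vertices). The join $G_1+G_2$ is the disjoint union plus all edges between $V(G_1)$ and $V(G_2)$. $K_{1,n}^*$ is obtained from $K_{1,n}$ by attaching a pendant vertex to each leaf. -}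

module Defs where

open import Data.Bool using (Bool; true; false; _∧_)
open import Data.Nat using (ℕ; zero; suc; _+_; _*_; _≤_; _<_; _≤ᵇ_)
open import Data.Fin using (Fin; zero; suc; splitAt; _≟_)
open import Data.Fin.Properties using (suc-injective)
open import Data.Sum using (_⊎_; inj₁; inj₂)
open import Data.Product using (Σ; ∃; _×_; _,_)
open import Relation.Nullary using (¬_; yes; no)
open import Relation.Binary.PropositionalEquality using (_≡_; refl)
open import Function.Definitions using (Injective)

record Graph : Set where
  field
    n      : ℕ
    adj    : Fin n → Fin n → Bool
    sym    : ∀ i j → adj i j ≡ adj j i
    irrefl : ∀ i → adj i i ≡ false
open Graph public

_≺_ : Graph → Graph → Set
H ≺ G = Σ (Fin (n H) → Fin (n G)) λ f →
          Injective _≡_ _≡_ f × (∀ i j → adj G (f i) (f j) ≡ adj H i j)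

Family : Set₁
Family = Graph → Set

Free : Family → Graph → Set
Free ℋ G = ∀ H → ℋ H → ¬ (H ≺ G)

_≤F_ : Family → Family → Set
ℋ₁ ≤F ℋ₂ = ∀ H₂ → ℋ₂ H₂ → ∃ λ H₁ → ℋ₁ H₁ × (H₁ ≺ H₂)

countᵇ : ∀ {m} → (Fin m → Bool) → ℕ
countᵇ {zero}  p = 0
countᵇ {suc m} p with p zero
... | true  = suc (countᵇ (λ i → p (suc i)))
... | false = countᵇ (λ i → p (suc i))

deg : (G : Graph) → Fin (n G) → ℕ
deg G i = countᵇ (adj G i)

#deg≥2 : Graph → ℕ
#deg≥2 G = countᵇ (λ i → 2 ≤ᵇ deg G i)

E : ℕ → Graph
E m = record { n = m ; adj = λ _ _ → false ; sym = λ _ _ → refl ; irrefl = λ _ → refl }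

eqᵇ : ∀ {m} → Fin m → Fin m → Bool
eqᵇ i j with i ≟ j
... | yes _ = true
... | no  _ = false

notᵇ : Bool → Bool
notᵇ true = false
notᵇ false = true

K : ℕ → Graph
K m = record { n = m ; adj = λ i j → notᵇ (eqᵇ i j) ; sym = s ; irrefl = r }
  where
  s : ∀ (i j : Fin m) → notᵇ (eqᵇ i j) ≡ notᵇ (eqᵇ j i)
  s i j with i ≟ j | j ≟ i
  ... | yes _ | yes _ = refl
  ... | no  _ | no  _ = refl
  ... | yes refl | no ¬p = Data.Empty.⊥-elim (¬p refl)
    where import Data.Empty
  ... | no ¬p | yes refl = Data.Empty.⊥-elim (¬p refl)
    where import Data.Empty
  r : ∀ (i : Fin m) → notᵇ (eqᵇ i i) ≡ false
  r i with i ≟ i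
  ... | yes _ = refl
  ... | no ¬p = Data.Empty.⊥-elim (¬p refl)
    where import Data.Empty

P3adj : Fin 3 → Fin 3 → Bool
P3adj zero (suc zero) = true
P3adj (suc zero) zero = true
P3adj (suc zero) (suc (suc zero)) = true
P3adj (suc (suc zero)) (suc zero) = true
P3adj _ _ = false

P3 : Graph
P3 = record { n = 3 ; adj = P3adj ; sym = s ; irrefl = r }
  where
  s : ∀ i j → P3adj i j ≡ P3adj j i
  s zero zero = refl
  s zero (suc zero) = refl
  s zero (suc (suc zero)) = refl
  s (suc zero) zero = refl
  s (suc zero) (suc zero) = refl
  s (suc zero) (suc (suc zero)) = refl
  s (suc (suc zero)) zero = refl
  s (suc (suc zero)) (suc zero) = refl
  s (suc (suc zero)) (suc (suc zero)) = refl
  r : ∀ i → P3adj i i ≡ false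
  r zero = refl
  r (suc zero) = refl
  r (suc (suc zero)) = refl

combine : Bool → Graph → Graph → Graph
combine cross G H = record { n = n G + n H ; adj = a ; sym = s ; irrefl = r }
  where
  a : Fin (n G + n H) → Fin (n G + n H) → Bool
  a i j with splitAt (n G) i | splitAt (n G) j
  ... | inj₁ x | inj₁ y = adj G x y
  ... | inj₂ x | inj₂ y = adj H x y
  ... | inj₁ _ | inj₂ _ = cross
  ... | inj₂ _ | inj₁ _ = cross
  s : ∀ i j → a i j ≡ a j i
  s i j with splitAt (n G) i | splitAt (n G) j
  ... | inj₁ x | inj₁ y = sym G x y
  ... | inj₂ x | inj₂ y = sym H x y
  ... | inj₁ _ | inj₂ _ = refl
  ... | inj₂ _ | inj₁ _ = refl
  r : ∀ i → a i i ≡ false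
  r i with splitAt (n G) i
  ... | inj₁ x = irrefl G x
  ... | inj₂ x = irrefl H x

_⊕_ : Graph → Graph → Graph
G ⊕ H = combine false G H

_⊞_ : Graph → Graph → Graph
G ⊞ H = combine true G H

copies : ℕ → Graph → Graph
copies zero    G = E 0
copies (suc k) G = G ⊕ copies k G

apex : (G : Graph) → (Fin (n G) → Bool) → Graph
apex G S = record { n = suc (n G) ; adj = a ; sym = s ; irrefl = r }
  where
  a : Fin (suc (n G)) → Fin (suc (n G)) → Bool
  a zero zero = false
  a zero (suc j) = S j
  a (suc i) zero = S i
  a (suc i) (suc j) = adj G i j
  s : ∀ i j → a i j ≡ a j i
  s zero zero = refl
  s zero (suc j) = refl
  s (suc i) zero = refl
  s (suc i) (suc j) = sym G i j
  r : ∀ i → a i i ≡ false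
  r zero = refl
  r (suc i) = irrefl G i

firstOfK2 : (k : ℕ) → Fin (n (copies k (K 2))) → Bool
firstOfK2 zero ()
firstOfK2 (suc k) i with splitAt 2 i
... | inj₁ zero = true
... | inj₁ (suc _) = false
... | inj₂ j = firstOfK2 k j

Kbip : ℕ → ℕ → Graph
Kbip s t = E s ⊞ E t

-- K*_{1,k}: K_{1,k} with a pendant vertex attached to each leaf
-- (centre adjacent to one endpoint of each of k disjoint edges).
K1star : ℕ → Graph
K1star k = apex (copies k (K 2)) (firstOfK2 k)

data Forb (k : ℕ) : Family where
  f-K     : Forb k (K k)
  f-P3    : Forb k (copies k P3)
  f-K3    : Forb k (copies k (K 3))
  f-star  : Forb k (K1star k)
  f-K2k   : Forb k (Kbip 2 k)
  f-K2E   : Forb k (K 2 ⊞ E k)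
  f-K1K2  : Forb k (K 1 ⊞ copies k (K 2))

module Submission where

-- (⇒) For k = c + 3 each of the seven graphs has at least k vertices of degree ≥ 2, so none of them
-- is ℋ-free: each contains a member of ℋ.
-- (⇐) Let G contain none of the seven graphs for k.  By Ramsey's theorem two vertices have fewer than
-- R(k,k) common neighbours, or G would contain K_k, K₂ + kK₁ or K_{2,k}.  Fix a vertex v.  Inside N(v)
-- all degrees are then below R(k,k), so a greedy induced matching shows that few neighbours of v lie
-- on a triangle with v (else K₁ + kK₂).  Every other neighbour u of degree ≥ 2 has a neighbour outside
-- N[v]; three Ramsey refinements of these pendant edges show that there are few such u (else K_k or
-- K*_{1,k}).  So each vertex has boundedly many neighbours of degree ≥ 2, and among many vertices of
-- degree ≥ 2 a greedy choice finds 2k whose closed neighbourhoods are pairwise disjoint and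
-- non-adjacent.  The cherries centred at them then span kK₃ or kP₃.

open import Defs hiding (sym)
open import Level using (0ℓ)
open import Axiom.ExcludedMiddle using (ExcludedMiddle)
open import Data.Bool using (Bool; true; false; _∧_) renaming (_≟_ to _≟ᵇ_)
open import Data.Bool.Properties using (¬-not; T-≡)
open import Data.Nat using (ℕ; zero; suc; _+_; _*_; _^_; _≤_; _<_; _≤?_; _≤ᵇ_; s≤s; z≤n)
open import Data.Nat.Properties
  using (+-suc; +-comm; *-suc; *-comm; ≤-refl; ≤-trans; ≤-reflexive; <⇒≤; ≰⇒>; <⇒≱; <-irrefl;
         m≤n+m; +-mono-≤; +-monoˡ-≤; +-monoʳ-≤; +-mono-<; *-monoˡ-≤; +-cancelˡ-≤; m≤n⇒m⊓n≡m;
         ≤⇒≤ᵇ; ≤ᵇ⇒≤; module ≤-Reasoning)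
import Data.Nat.Properties as ℕ
open import Data.Fin using (Fin; zero; suc; splitAt; join; _↑ˡ_; _↑ʳ_)
import Data.Fin as Fin
open import Data.Fin.Properties
  using (join-splitAt; splitAt-↑ˡ; splitAt-↑ʳ; ↑ˡ-injective; ↑ʳ-injective; suc-injective)
open import Data.List
  using (List; []; _∷_; [_]; _++_; length; filter; concatMap; lookup; map; take; tabulate; allFin;
         initLast; _∷ʳ′_)
open import Data.List.Properties using (length-++; length-map; length-take; length-tabulate; filter-notAll)
open import Data.List.Membership.Propositional using (_∈_; _∉_; lose)
open import Data.List.Membership.Propositional.Properties
  using (∈-filter⁺; ∈-filter⁻; ∈-lookup; ∈-allFin; ∈-++⁺ˡ; ∈-++⁺ʳ; ∈-concatMap⁺)
import Data.List.Relation.Unary.Any as Any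
open import Data.List.Relation.Unary.Any using (here; there)
open import Data.List.Relation.Unary.All as All using (All; []; _∷_)
import Data.List.Relation.Unary.All.Properties as All
open import Data.List.Relation.Unary.AllPairs as AllPairs using (AllPairs; []; _∷_)
import Data.List.Relation.Unary.AllPairs.Properties as AllPairs
open import Data.List.Relation.Unary.Unique.Propositional using (Unique)
import Data.List.Relation.Unary.Unique.Propositional.Properties as Unique
open import Data.List.Relation.Binary.Sublist.Propositional
  using (_⊆_; []; _∷_; _∷ʳ_; ⊆-refl; ⊆-trans; minimum)
open import Data.List.Relation.Binary.Sublist.Propositional.Properties
  using (All-resp-⊆; filter-⊆; take-⊆; ++⁺ʳ)
open import Data.Product using (Σ; ∃; ∃₂; ∃-syntax; _×_; _,_; proj₁; proj₂)
open import Data.Sum as Sum using (_⊎_; inj₁; inj₂)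
open import Data.Empty using (⊥; ⊥-elim)
open import Function using (_∘_; id; Equivalence)
open import Function.Definitions using (Injective)
open import Relation.Nullary using (¬_; Dec; yes; no; ¬?)
import Relation.Unary
open import Relation.Binary using (Rel; Decidable; DecidableEquality; Symmetric)
open import Relation.Binary.PropositionalEquality
  using (_≡_; _≢_; refl; sym; trans; cong; cong₂; subst; ≢-sym; module ≡-Reasoning)

private variable
  A : Set

+-≤-split : ∀ m n {p q} → m + n ≤ p + q → m ≤ p ⊎ n ≤ q
+-≤-split m n {p} {q} m+n≤p+q with m ≤? p
... | yes m≤p = inj₁ m≤p
... | no  m≰p = inj₂ (+-cancelˡ-≤ p n q (≤-trans (+-monoˡ-≤ n (<⇒≤ (≰⇒> m≰p))) m+n≤p+q))

AllPairs-resp-⊆ : {R : Rel A 0ℓ} {xs ys : List A} → xs ⊆ ys → AllPairs R ys → AllPairs R xs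
AllPairs-resp-⊆ []           []        = []
AllPairs-resp-⊆ (_ ∷ʳ xs⊆)   (_ ∷ rs) = AllPairs-resp-⊆ xs⊆ rs
AllPairs-resp-⊆ (refl ∷ xs⊆) (r ∷ rs) = All-resp-⊆ xs⊆ r ∷ AllPairs-resp-⊆ xs⊆ rs

AllPairs-∷ʳ⁻ : {R : Rel A 0ℓ} (xs : List A) {z : A} → AllPairs R (xs ++ [ z ]) → All (λ x → R x z) xs
AllPairs-∷ʳ⁻ []       _        = []
AllPairs-∷ʳ⁻ (x ∷ xs) (r ∷ rs) = All.lookup r (∈-++⁺ʳ xs (here refl)) ∷ AllPairs-∷ʳ⁻ xs rs

AllPairs-lookup : {R : Rel A 0ℓ} → Symmetric R → {xs : List A} → AllPairs R xs →
                  ∀ {i j} → i ≢ j → R (lookup xs i) (lookup xs j)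
AllPairs-lookup R-sym (r ∷ rs) {zero}  {zero}  i≢j = ⊥-elim (i≢j refl)
AllPairs-lookup R-sym (r ∷ rs) {zero}  {suc j} _   = All.lookup r (∈-lookup j)
AllPairs-lookup R-sym (r ∷ rs) {suc i} {zero}  _   = R-sym (All.lookup r (∈-lookup i))
AllPairs-lookup R-sym (r ∷ rs) {suc i} {suc j} i≢j = AllPairs-lookup R-sym rs (i≢j ∘ cong suc)

length-concatMap-≤ : {B : Set} (f : A → List B) {b : ℕ} {xs : List A} →
                     All (λ x → length (f x) ≤ b) xs → length (concatMap f xs) ≤ length xs * b
length-concatMap-≤ f {xs = []}     []           = z≤n
length-concatMap-≤ f {xs = x ∷ xs} (fx≤b ∷ f≤b) =
  ≤-trans (≤-reflexive (length-++ (f x))) (+-mono-≤ fx≤b (length-concatMap-≤ f f≤b))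

two-members : {xs : List A} → Unique xs → 2 ≤ length xs → ∃₂ λ a b → a ≢ b × a ∈ xs × b ∈ xs
two-members {xs = a ∷ b ∷ _} ((a≢b ∷ _) ∷ _) _ = a , b , a≢b , here refl , there (here refl)
two-members {xs = _ ∷ []}    _ (s≤s ())

length-filter-∁ : {P : A → Set} (P? : Relation.Unary.Decidable P) (xs : List A) →
                  length (filter P? xs) + length (filter (¬? ∘ P?) xs) ≡ length xs
length-filter-∁ P? []       = refl
length-filter-∁ P? (x ∷ xs) with P? x
... | yes _ = cong suc (length-filter-∁ P? xs)
... | no  _ = trans (+-suc _ _) (cong suc (length-filter-∁ P? xs))

module _ (_≟_ : DecidableEquality A) where

  unique-length-≤ : {xs ys : List A} → Unique xs → (∀ {x} → x ∈ xs → x ∈ ys) → length xs ≤ length ys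
  unique-length-≤ {[]}              _        _     = z≤n
  unique-length-≤ {x ∷ xs} {ys} (x∉xs ∷ u) xs⊆ys = begin
    suc (length xs)   ≤⟨ s≤s (unique-length-≤ u xs⊆ys-x) ⟩
    suc (length ys-x) ≤⟨ filter-notAll _ ys (Any.map (λ { refl ¬¬x≡x → ¬¬x≡x refl }) (xs⊆ys (here refl))) ⟩
    length ys         ∎
    where
    open ≤-Reasoning
    ys-x = filter (λ y → ¬? (y ≟ x)) ys
    xs⊆ys-x : ∀ {y} → y ∈ xs → y ∈ ys-x
    xs⊆ys-x y∈ = ∈-filter⁺ _ (xs⊆ys (there y∈)) λ { refl → All.lookup x∉xs y∈ refl }

take-filter : {P : A → Set} (P? : Relation.Unary.Decidable P) {m : ℕ} (xs : List A) →
              m ≤ length (filter P? xs) → ∃ λ ys → ys ⊆ xs × length ys ≡ m × All P ys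
take-filter P? {m} xs m≤ =
  take m (filter P? xs) , ⊆-trans (take-⊆ m _) (filter-⊆ P? xs) ,
  trans (length-take m _) (m≤n⇒m⊓n≡m m≤) , All-resp-⊆ (take-⊆ m _) (All.all-filter P? xs)

majority : {P : A → Set} (P? : Relation.Unary.Decidable P) (m : ℕ) (xs : List A) → m + m ≤ length xs →
           (∃ λ ys → ys ⊆ xs × length ys ≡ m × All P ys) ⊎
           (∃ λ ys → ys ⊆ xs × length ys ≡ m × All (¬_ ∘ P) ys)
majority P? m xs big =
  Sum.map (take-filter P? xs) (take-filter (¬? ∘ P?) xs)
          (+-≤-split m m (≤-trans big (≤-reflexive (sym (length-filter-∁ P? xs)))))

-- Ramsey's theorem and greedy selection

record Clique (R : Rel A 0ℓ) (m : ℕ) (xs : List A) : Set where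
  constructor clique
  field
    members  : List A
    sublist  : members ⊆ xs
    size     : length members ≡ m
    pairwise : AllPairs R members

module _ {R : Rel A 0ℓ} where

  empty-clique : (xs : List A) → Clique R 0 xs
  empty-clique xs = clique [] (minimum xs) refl []

  Clique-resp-⊆ : ∀ {m xs ys} → xs ⊆ ys → Clique R m xs → Clique R m ys
  Clique-resp-⊆ xs⊆ys (clique zs zs⊆ size rs) = clique zs (⊆-trans zs⊆ xs⊆ys) size rs

  cons-clique : ∀ {m x xs ys} → ys ⊆ xs → All (R x) ys → Clique R m ys → Clique R (suc m) (x ∷ xs)
  cons-clique ys⊆ Rx (clique zs zs⊆ refl rs) =
    clique (_ ∷ zs) (refl ∷ ⊆-trans zs⊆ ys⊆) refl (All-resp-⊆ zs⊆ Rx ∷ rs)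

ramsey : ℕ → ℕ → ℕ
ramsey zero    _       = 0
ramsey (suc a) zero    = 0
ramsey (suc a) (suc b) = suc (ramsey a (suc b) + ramsey (suc a) b)

module _ {R : Rel A 0ℓ} (R? : Decidable R) where

  ramsey-clique : ∀ a b xs → ramsey a b ≤ length xs → Clique R a xs ⊎ Clique (λ x y → ¬ R x y) b xs
  ramsey-clique zero    b       xs       _         = inj₁ (empty-clique xs)
  ramsey-clique (suc a) zero    xs       _         = inj₂ (empty-clique xs)
  ramsey-clique (suc a) (suc b) (x ∷ xs) (s≤s big)
    with +-≤-split (ramsey a (suc b)) (ramsey (suc a) b)
                   (≤-trans big (≤-reflexive (sym (length-filter-∁ (R? x) xs))))
  ... | inj₁ many-related =
    Sum.map (cons-clique (filter-⊆ _ xs) (All.all-filter (R? x) xs))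
            (Clique-resp-⊆ (x ∷ʳ filter-⊆ _ xs))
            (ramsey-clique a (suc b) (filter (R? x) xs) many-related)
  ... | inj₂ many-unrelated =
    Sum.map (Clique-resp-⊆ (x ∷ʳ filter-⊆ _ xs))
            (cons-clique (filter-⊆ _ xs) (All.all-filter (¬? ∘ R? x) xs))
            (ramsey-clique (suc a) b (filter (¬? ∘ R? x) xs) many-unrelated)

module _ {R S : Rel A 0ℓ} (S? : Decidable S) where

  refine-clique : ∀ {a b m xs} (c : Clique R m xs) → ramsey a b ≤ m → ¬ Clique S a (Clique.members c) →
                  Clique (λ x y → R x y × ¬ S x y) b xs
  refine-clique {a} {b} (clique ys ys⊆ refl rs) big no-S-clique with ramsey-clique S? a b ys big
  ... | inj₁ S-clique                  = ⊥-elim (no-S-clique S-clique)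
  ... | inj₂ (clique zs zs⊆ size ¬Ss) =
    clique zs (⊆-trans zs⊆ ys⊆) size (AllPairs.zip (AllPairs-resp-⊆ zs⊆ rs , ¬Ss))

module _ (_≟_ : DecidableEquality A) (C : Rel A 0ℓ) (B : A → List A) (b : ℕ) where

  open import Data.List.Membership.DecPropositional _≟_ using (_∈?_)

  greedy-clique : ∀ j xs → Unique xs → All (λ x → length (B x) ≤ b) xs →
                  (∀ {x y} → x ∈ xs → y ∈ xs → y ∉ B x → C x y) →
                  j * suc b ≤ length xs → Clique C j xs
  greedy-clique zero    xs       _       _            _    _         = empty-clique xs
  greedy-clique (suc j) (x ∷ xs) (_ ∷ u) (Bx≤b ∷ B≤b) C-ok (s≤s big) =
    cons-clique (filter-⊆ _ xs) (All.tabulate C-x)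
      (greedy-clique j far (Unique.filter⁺ _ u) (All-resp-⊆ (filter-⊆ _ xs) B≤b)
                     (λ y∈ z∈ → C-ok (there (from-far y∈)) (there (from-far z∈))) enough-far)
    where
    in-B? : Relation.Unary.Decidable (_∈ B x)
    in-B? y = y ∈? B x
    far near : List A
    far  = filter (¬? ∘ in-B?) xs
    near = filter in-B? xs
    from-far : ∀ {y} → y ∈ far → y ∈ xs
    from-far y∈ = proj₁ (∈-filter⁻ (¬? ∘ in-B?) {xs = xs} y∈)
    C-x : ∀ {y} → y ∈ far → C x y
    C-x y∈ = C-ok (here refl) (there (from-far y∈)) (proj₂ (∈-filter⁻ (¬? ∘ in-B?) {xs = xs} y∈))
    near≤b : length near ≤ b
    near≤b = ≤-trans (unique-length-≤ _≟_ (Unique.filter⁺ in-B? u) (proj₂ ∘ ∈-filter⁻ in-B? {xs = xs}))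
                     Bx≤b
    enough-far : j * suc b ≤ length far
    enough-far = +-cancelˡ-≤ b _ _ (begin
      b + j * suc b            ≤⟨ big ⟩
      length xs                ≡⟨ length-filter-∁ in-B? xs ⟨
      length near + length far ≤⟨ +-monoˡ-≤ (length far) near≤b ⟩
      b + length far           ∎)
      where open ≤-Reasoning

∧≡true⇒ : ∀ {a b} → a ∧ b ≡ true → a ≡ true × b ≡ true
∧≡true⇒ {true} {true} _ = refl , refl

countᵇ-tabulate : ∀ {m} {A : Set} (f : Fin m → A) (q : A → Bool) →
                  countᵇ (q ∘ f) ≡ length (filter (λ a → q a ≟ᵇ true) (tabulate f))
countᵇ-tabulate {zero}  f q = refl
countᵇ-tabulate {suc m} f q with q (f zero)
... | true  = cong suc (countᵇ-tabulate (f ∘ suc) q)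
... | false = countᵇ-tabulate (f ∘ suc) q

support : ∀ {m} → (Fin m → Bool) → List (Fin m)
support p = filter (λ i → p i ≟ᵇ true) (allFin _)

length-support : ∀ {m} (p : Fin m → Bool) → length (support p) ≡ countᵇ p
length-support p = sym (countᵇ-tabulate id p)

support-unique : ∀ {m} (p : Fin m → Bool) → Unique (support p)
support-unique {m} p = Unique.filter⁺ _ (Unique.allFin⁺ m)

∈-support⁺ : ∀ {m} {p : Fin m → Bool} {i} → p i ≡ true → i ∈ support p
∈-support⁺ {p = p} = ∈-filter⁺ (λ i → p i ≟ᵇ true) (∈-allFin _)

∈-support⁻ : ∀ {m} {p : Fin m → Bool} {i} → i ∈ support p → p i ≡ true
∈-support⁻ {m} {p} = proj₂ ∘ ∈-filter⁻ (λ i → p i ≟ᵇ true) {xs = allFin m}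

unique-length-≤-countᵇ : ∀ {m} {p : Fin m → Bool} {xs} → Unique xs → All (λ i → p i ≡ true) xs →
                         length xs ≤ countᵇ p
unique-length-≤-countᵇ {p = p} u ps =
  subst (_ ≤_) (length-support p) (unique-length-≤ Fin._≟_ u (∈-support⁺ ∘ All.lookup ps))

-- Graphs and induced subgraphs

≺-trans : {F H G : Graph} → F ≺ H → H ≺ G → F ≺ G
≺-trans (f , f-inj , f-adj) (g , g-inj , g-adj) =
  g ∘ f , f-inj ∘ g-inj , λ i j → trans (g-adj (f i) (f j)) (f-adj i j)

K-adj : ∀ {m} {i j : Fin m} → i ≢ j → adj (K m) i j ≡ true
K-adj {i = i} {j} i≢j with i Fin.≟ j
... | yes i≡j = ⊥-elim (i≢j i≡j)
... | no  _   = refl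

copyIndex : ∀ {A} k → Fin (n (copies k A)) → Fin (n A)
copyIndex {A} (suc k) j = Sum.[ id , copyIndex k ] (splitAt (n A) j)

isFirst : Fin 2 → Bool
isFirst zero    = true
isFirst (suc _) = false

firstOfK2-copyIndex : ∀ k j → firstOfK2 k j ≡ isFirst (copyIndex {K 2} k j)
firstOfK2-copyIndex (suc k) j with splitAt 2 j
... | inj₁ zero       = refl
... | inj₁ (suc zero) = refl
... | inj₂ j′         = firstOfK2-copyIndex k j′

module Adjacency (G : Graph) where

  V : Set
  V = Fin (n G)

  infix 4 _~_ _≁_

  _~_ _≁_ : V → V → Set
  x ~ y = adj G x y ≡ true
  x ≁ y = adj G x y ≡ false

  _~?_ : Decidable _~_
  x ~? y = adj G x y ≟ᵇ true

  ~-sym : ∀ {x y} → x ~ y → y ~ x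
  ~-sym {x} {y} = trans (Graph.sym G y x)

  ≁-sym : ∀ {x y} → x ≁ y → y ≁ x
  ≁-sym {x} {y} = trans (Graph.sym G y x)

  ~⇒≢ : ∀ {x y} → x ~ y → x ≢ y
  ~⇒≢ {x} x~x refl with trans (sym x~x) (irrefl G x)
  ... | ()

  ¬~⇒≁ : ∀ {x y} → ¬ x ~ y → x ≁ y
  ¬~⇒≁ = ¬-not

  ≁⇒¬~ : ∀ {x y} → x ≁ y → ¬ x ~ y
  ≁⇒¬~ x≁y x~y with trans (sym x~y) x≁y
  ... | ()

  deg≥2⇒two-neighbours : ∀ {x} → 2 ≤ deg G x → ∃₂ λ a b → a ≢ b × x ~ a × x ~ b
  deg≥2⇒two-neighbours {x} 2≤deg
    with a , b , a≢b , a∈ , b∈ ← two-members (support-unique (adj G x))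
                                   (subst (2 ≤_) (sym (length-support (adj G x))) 2≤deg)
    = a , b , a≢b , ∈-support⁻ a∈ , ∈-support⁻ b∈

  two-neighbours⇒deg≥2 : ∀ {x a b} → a ≢ b → x ~ a → x ~ b → 2 ≤ deg G x
  two-neighbours⇒deg≥2 a≢b x~a x~b = unique-length-≤-countᵇ ((a≢b ∷ []) ∷ [] ∷ []) (x~a ∷ x~b ∷ [])

  isBranchᵇ : V → Bool
  isBranchᵇ x = 2 ≤ᵇ deg G x

  isBranchᵇ⁺ : ∀ {x} → 2 ≤ deg G x → isBranchᵇ x ≡ true
  isBranchᵇ⁺ = Equivalence.to T-≡ ∘ ≤⇒≤ᵇ

  isBranchᵇ⁻ : ∀ {x} → isBranchᵇ x ≡ true → 2 ≤ deg G x
  isBranchᵇ⁻ {x} = ≤ᵇ⇒≤ 2 (deg G x) ∘ Equivalence.from T-≡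

module Embeddings (G : Graph) where

  open Adjacency G

  ≺-by : {H : Graph} (f : Fin (n H) → V) → (∀ {i j} → i ≢ j → f i ≢ f j) →
         (∀ {i j} → i ≢ j → adj G (f i) (f j) ≡ adj H i j) → H ≺ G
  ≺-by {H} f f-≢ f-adj = f , injective , adjacency
    where
    injective : Injective _≡_ _≡_ f
    injective {i} {j} fi≡fj with i Fin.≟ j
    ... | yes i≡j = i≡j
    ... | no  i≢j = ⊥-elim (f-≢ i≢j fi≡fj)
    adjacency : ∀ i j → adj G (f i) (f j) ≡ adj H i j
    adjacency i j with i Fin.≟ j
    ... | yes refl = trans (irrefl G (f i)) (sym (irrefl H i))
    ... | no  i≢j  = f-adj i≢j

  K-≺ : {xs : List V} → AllPairs _~_ xs → K (length xs) ≺ G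
  K-≺ {xs} clq = ≺-by {K (length xs)} (lookup xs) (~⇒≢ ∘ AllPairs-lookup ~-sym {xs} clq)
                      (λ i≢j → trans (AllPairs-lookup ~-sym {xs} clq i≢j) (sym (K-adj i≢j)))

  E-≺ : {xs : List V} → Unique xs → AllPairs _≁_ xs → E (length xs) ≺ G
  E-≺ {xs} u ind =
    ≺-by {E (length xs)} (lookup xs) (AllPairs-lookup ≢-sym {xs} u) (AllPairs-lookup ≁-sym {xs} ind)

  P3-≺ : ∀ {a v b} → a ~ v → v ~ b → a ≁ b → a ≢ b → P3 ≺ G
  P3-≺ {a} {v} {b} a~v v~b a≁b a≢b =
    ≺-by {P3} (lookup (a ∷ v ∷ b ∷ []))
         (AllPairs-lookup ≢-sym {a ∷ v ∷ b ∷ []} ((~⇒≢ a~v ∷ a≢b ∷ []) ∷ (~⇒≢ v~b ∷ []) ∷ [] ∷ []))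
         path
    where
    path : ∀ {i j} → i ≢ j → adj G (lookup (a ∷ v ∷ b ∷ []) i) (lookup (a ∷ v ∷ b ∷ []) j) ≡ P3adj i j
    path {zero}           {suc zero}       _   = a~v
    path {zero}           {suc (suc zero)} _   = a≁b
    path {suc zero}       {zero}           _   = ~-sym a~v
    path {suc zero}       {suc (suc zero)} _   = v~b
    path {suc (suc zero)} {zero}           _   = ≁-sym a≁b
    path {suc (suc zero)} {suc zero}       _   = ~-sym v~b
    path {zero}           {zero}           i≢i = ⊥-elim (i≢i refl)
    path {suc zero}       {suc zero}       i≢i = ⊥-elim (i≢i refl)
    path {suc (suc zero)} {suc (suc zero)} i≢i = ⊥-elim (i≢i refl)

  combine-≺ : {A B : Graph} (b : Bool) (e₁ : A ≺ G) (e₂ : B ≺ G) →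
              (∀ i j → proj₁ e₁ i ≢ proj₁ e₂ j) → (∀ i j → adj G (proj₁ e₁ i) (proj₁ e₂ j) ≡ b) →
              combine b A B ≺ G
  combine-≺ {A} {B} b (f₁ , f₁-inj , f₁-adj) (f₂ , f₂-inj , f₂-adj) disjoint across =
    f , injective , adjacency
    where
    f : Fin (n A + n B) → V
    f = Sum.[ f₁ , f₂ ] ∘ splitAt (n A)
    parts-injective : (p q : Fin (n A) ⊎ Fin (n B)) → Sum.[ f₁ , f₂ ] p ≡ Sum.[ f₁ , f₂ ] q → p ≡ q
    parts-injective (inj₁ x) (inj₁ y) eq = cong inj₁ (f₁-inj eq)
    parts-injective (inj₂ x) (inj₂ y) eq = cong inj₂ (f₂-inj eq)
    parts-injective (inj₁ x) (inj₂ y) eq = ⊥-elim (disjoint x y eq)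
    parts-injective (inj₂ x) (inj₁ y) eq = ⊥-elim (disjoint y x (sym eq))
    injective : Injective _≡_ _≡_ f
    injective {i} {j} fi≡fj = begin
      i               ≡⟨ join-splitAt (n A) (n B) i ⟨
      merge (split i) ≡⟨ cong merge (parts-injective (split i) (split j) fi≡fj) ⟩
      merge (split j) ≡⟨ join-splitAt (n A) (n B) j ⟩
      j               ∎
      where
      open ≡-Reasoning
      split = splitAt (n A)
      merge = join (n A) (n B)
    adjacency : ∀ i j → adj G (f i) (f j) ≡ adj (combine b A B) i j
    adjacency i j with splitAt (n A) i | splitAt (n A) j
    ... | inj₁ x | inj₁ y = f₁-adj x y
    ... | inj₂ x | inj₂ y = f₂-adj x y
    ... | inj₁ x | inj₂ y = across x y
    ... | inj₂ x | inj₁ y = trans (Graph.sym G (f₂ x) (f₁ y)) (across y x)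

  apex-≺ : {A : Graph} {S : Fin (n A) → Bool} (e : A ≺ G) (h : V) →
           (∀ i → proj₁ e i ≢ h) → (∀ i → adj G h (proj₁ e i) ≡ S i) → apex A S ≺ G
  apex-≺ {A} {S} (f , f-inj , f-adj) h h∉ h-adj = g , injective , adjacency
    where
    g : Fin (suc (n A)) → V
    g zero    = h
    g (suc i) = f i
    injective : Injective _≡_ _≡_ g
    injective {zero}  {zero}  _  = refl
    injective {zero}  {suc j} eq = ⊥-elim (h∉ j (sym eq))
    injective {suc i} {zero}  eq = ⊥-elim (h∉ i eq)
    injective {suc i} {suc j} eq = cong suc (f-inj eq)
    adjacency : ∀ i j → adj G (g i) (g j) ≡ adj (apex A S) i j
    adjacency zero    zero    = irrefl G h
    adjacency zero    (suc j) = h-adj j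
    adjacency (suc i) zero    = trans (Graph.sym G (f i) h) (h-adj i)
    adjacency (suc i) (suc j) = f-adj i j

  join-E-≺ : {A : Graph} (e : A ≺ G) {ys : List V} → Unique ys → AllPairs _≁_ ys →
             (∀ i → All (proj₁ e i ~_) ys) → (A ⊞ E (length ys)) ≺ G
  join-E-≺ {A} e {ys} u ind adjacent =
    combine-≺ {A} {E (length ys)} true e (E-≺ u ind)
      (λ i j → ~⇒≢ (All.lookup (adjacent i) (∈-lookup j)))
      (λ i j → All.lookup (adjacent i) (∈-lookup j))

  cone-≺ : {A : Graph} (v : V) (e : A ≺ G) → (∀ j → v ~ proj₁ e j) → (K 1 ⊞ A) ≺ G
  cone-≺ {A} v e v~ = combine-≺ {K 1} {A} true (K-≺ {v ∷ []} ([] ∷ [])) e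
                        (λ { zero j → ~⇒≢ (v~ j) }) (λ { zero j → v~ j })

  Apart : ∀ {a b} → (Fin a → V) → (Fin b → V) → Set
  Apart f g = ∀ i j → f i ≢ g j × f i ≁ g j

  -- Vertex j of the copies is vertex copyIndex j of some mk px; the second component states this
  -- as a transfer principle for properties Q.
  copies-≺ : {A : Graph} {P : V → Set} (mk : ∀ {x} → P x → A ≺ G) {xs : List V} → All P xs →
             AllPairs (λ x y → ∀ {px : P x} {py : P y} → Apart (proj₁ (mk px)) (proj₁ (mk py))) xs →
             Σ (copies (length xs) A ≺ G) λ e →
               (Q : V → Fin (n A) → Set) → (∀ {x} → x ∈ xs → (px : P x) → ∀ i → Q (proj₁ (mk px) i) i) →
               ∀ j → Q (proj₁ e j) (copyIndex (length xs) j)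
  copies-≺ mk []         []                = ((λ ()) , (λ { {()} }) , λ ()) , λ _ _ ()
  copies-≺ {A} {P} mk {x ∷ xs} (px ∷ pxs) (apart ∷ aparts) = whole , image
    where
    rest       = proj₁ (copies-≺ mk pxs aparts)
    rest-image = proj₂ (copies-≺ mk pxs aparts)
    separated : ∀ i j → proj₁ (mk px) i ≢ proj₁ rest j × proj₁ (mk px) i ≁ proj₁ rest j
    separated i j = rest-image (λ w _ → ∀ i → proj₁ (mk px) i ≢ w × proj₁ (mk px) i ≁ w)
                               (λ y∈ py l i → All.lookup apart y∈ {px} {py} i l) j i
    whole : copies (suc (length xs)) A ≺ G
    whole = combine-≺ {A} {copies (length xs) A} false (mk px) rest
              (λ i j → proj₁ (separated i j)) (λ i j → proj₂ (separated i j))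
    image : (Q : V → Fin (n A) → Set) → (∀ {y} → y ∈ x ∷ xs → (py : P y) → ∀ i → Q (proj₁ (mk py) i) i) →
            ∀ j → Q (proj₁ whole j) (copyIndex (suc (length xs)) j)
    image Q Q-mk j with splitAt (n A) j
    ... | inj₁ i  = Q-mk (here refl) px i
    ... | inj₂ j′ = rest-image Q (Q-mk ∘ there) j′

-- Graphs without the seven forbidden subgraphs

-- ρ bounds common neighbourhoods, b₂ the sets blocked by one edge of the induced matching, β and γ₂
-- the neighbours of degree ≥ 2 on a triangle resp. isolated in the neighbourhood, and γ all of them,
-- hence γ ^ 3 the balls of radius 3 from which 2k far apart vertices of degree ≥ 2 are picked greedily.
module Bounds (k : ℕ) where

  ρ : ℕ
  ρ = ramsey k k

  b₂ : ℕ
  b₂ = (2 + (ρ + ρ)) * suc ρ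

  β : ℕ
  β = k * suc b₂

  γ₂ : ℕ
  γ₂ = ramsey k (ramsey (suc ρ) (ramsey (suc ρ) k))

  γ : ℕ
  γ = β + γ₂

  branchBound : ℕ
  branchBound = (k + k) * suc (γ ^ 3)

module ForbFree (em : ExcludedMiddle 0ℓ) (k : ℕ) (G : Graph) (free : Free (Forb k) G) where

  open Adjacency G
  open Embeddings G
  open Bounds k

  choose : {A : Set} (P : A → Set) → A → A
  choose P default with em {∃ P}
  ... | yes (x , _) = x
  ... | no  _       = default

  choose-spec : {A : Set} {P : A → Set} (default : A) → ∃ P → P (choose P default)
  choose-spec {P = P} default ∃P with em {∃ P}
  ... | yes (_ , Px) = Px
  ... | no  ∄P       = ⊥-elim (∄P ∃P)

  common-neighbours-bound : ∀ {x y zs} → x ≢ y → Unique zs → All (λ z → x ~ z × y ~ z) zs → length zs < ρ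
  common-neighbours-bound {x} {y} {zs} x≢y u common = ≰⇒> no-large
    where
    x,y~ : ∀ {ys} → All (λ z → x ~ z × y ~ z) ys → ∀ i → All (lookup (x ∷ y ∷ []) i ~_) ys
    x,y~ common zero       = All.map proj₁ common
    x,y~ common (suc zero) = All.map proj₂ common
    no-book : ∀ {ys} → ys ⊆ zs → AllPairs (λ a b → ¬ a ~ b) ys → length ys ≡ k → ⊥
    no-book {ys} ys⊆ ind refl = no-pair (x ~? y)
      where
      book : ∀ {A} (e : A ≺ G) → (∀ i → All (proj₁ e i ~_) ys) → (A ⊞ E (length ys)) ≺ G
      book e = join-E-≺ e (AllPairs-resp-⊆ ys⊆ u) (AllPairs.map ¬~⇒≁ ind)
      no-pair : Dec (x ~ y) → ⊥
      no-pair (yes x~y) = free _ f-K2E (book (K-≺ ((x~y ∷ []) ∷ [] ∷ [])) (x,y~ (All-resp-⊆ ys⊆ common)))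
      no-pair (no  x≁y) = free _ f-K2k (book (E-≺ ((x≢y ∷ []) ∷ [] ∷ []) ((¬~⇒≁ x≁y ∷ []) ∷ [] ∷ []))
                                             (x,y~ (All-resp-⊆ ys⊆ common)))
    no-large : ρ ≤ length zs → ⊥
    no-large ρ≤ with ramsey-clique _~?_ k k zs ρ≤
    ... | inj₁ (clique _ _   refl clq) = free _ f-K (K-≺ clq)
    ... | inj₂ (clique _ ys⊆ size ind) = no-book ys⊆ ind size

  OnTriangle : V → V → Set
  OnTriangle v x = v ~ x × ∃[ y ] (v ~ y × x ~ y)

  module Triangles (v : V) where

    partner : V → V
    partner x = choose (λ y → v ~ y × x ~ y) x

    partner-spec : ∀ {x} → OnTriangle v x → v ~ partner x × x ~ partner x
    partner-spec {x} (_ , ∃y) = choose-spec x ∃y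

    edge : ∀ {x} → OnTriangle v x → K 2 ≺ G
    edge {x} t = K-≺ {x ∷ partner x ∷ []} ((proj₂ (partner-spec t) ∷ []) ∷ [] ∷ [])

    v~edge : ∀ {x} (t : OnTriangle v x) i → v ~ proj₁ (edge t) i
    v~edge t zero       = proj₁ t
    v~edge t (suc zero) = proj₁ (partner-spec t)

    common : V → List V
    common z = support (λ y → adj G v y ∧ adj G z y)

    ∈-common⁺ : ∀ {y z} → v ~ y → z ~ y → y ∈ common z
    ∈-common⁺ v~y z~y = ∈-support⁺ (cong₂ _∧_ v~y z~y)

    length-common : ∀ {z} → v ~ z → length (common z) ≤ ρ
    length-common v~z =
      <⇒≤ (common-neighbours-bound (~⇒≢ v~z) (support-unique _) (All.tabulate (∧≡true⇒ ∘ ∈-support⁻)))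

    -- Inside N(v): closed x is the closed neighbourhood of the edge x — partner x, and blocked x adds
    -- the neighbours of that.
    closed blocked : V → List V
    closed x  = x ∷ partner x ∷ common x ++ common (partner x)
    blocked x = closed x ++ concatMap common (closed x)

    v~closed : ∀ {x} → OnTriangle v x → All (v ~_) (closed x)
    v~closed t = proj₁ t ∷ proj₁ (partner-spec t) ∷ All.++⁺ (v~common _) (v~common _)
      where
      v~common : ∀ z → All (v ~_) (common z)
      v~common z = All.tabulate (proj₁ ∘ ∧≡true⇒ ∘ ∈-support⁻)

    length-closed : ∀ {x} → OnTriangle v x → length (closed x) ≤ 2 + (ρ + ρ)
    length-closed {x} t =
      s≤s (s≤s (≤-trans (≤-reflexive (length-++ (common x)))
                        (+-mono-≤ (length-common (proj₁ t)) (length-common (proj₁ (partner-spec t))))))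

    length-blocked : ∀ {x} → OnTriangle v x → length (blocked x) ≤ b₂
    length-blocked {x} t = begin
      length (blocked x)                                        ≡⟨ length-++ (closed x) ⟩
      length (closed x) + length (concatMap common (closed x)) ≤⟨ +-monoʳ-≤ (length (closed x)) common-≤ ⟩
      length (closed x) + length (closed x) * ρ                ≡⟨ *-suc (length (closed x)) ρ ⟨
      length (closed x) * suc ρ                                ≤⟨ *-monoˡ-≤ (suc ρ) (length-closed t) ⟩
      b₂                                                       ∎
      where
      open ≤-Reasoning
      common-≤ = length-concatMap-≤ common (All.map length-common (v~closed t))

    outside-closed : ∀ {x z} (t : OnTriangle v x) → v ~ z → z ∉ closed x →
                     ∀ i → proj₁ (edge t) i ≢ z × proj₁ (edge t) i ≁ z
    outside-closed t v~z z∉ zero =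
      (λ { refl → z∉ (here refl) }) ,
      ¬~⇒≁ (λ x~z → z∉ (there (there (∈-++⁺ˡ (∈-common⁺ v~z x~z)))))
    outside-closed {x} t v~z z∉ (suc zero) =
      (λ { refl → z∉ (there (here refl)) }) ,
      ¬~⇒≁ (λ p~z → z∉ (there (there (∈-++⁺ʳ (common x) (∈-common⁺ v~z p~z)))))

    -- Were partner y in closed x, then y ∈ common (partner y) would lie in blocked x.
    apart-if-unblocked : ∀ {x y} (tx : OnTriangle v x) (ty : OnTriangle v y) → y ∉ blocked x →
                         Apart (proj₁ (edge tx)) (proj₁ (edge ty))
    apart-if-unblocked {x} tx ty y∉ i j = outside-closed tx (v~edge ty j) (unblocked j) i
      where
      unblocked : ∀ j → proj₁ (edge ty) j ∉ closed x
      unblocked zero       y∈ = y∉ (∈-++⁺ˡ y∈)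
      unblocked (suc zero) p∈ =
        y∉ (∈-++⁺ʳ (closed x) (∈-concatMap⁺ common
              (lose p∈ (∈-common⁺ (proj₁ ty) (~-sym (proj₂ (partner-spec ty)))))))

    triangle-bound : ∀ {xs} → Unique xs → All (OnTriangle v) xs → length xs < β
    triangle-bound {xs} u ts = ≰⇒> λ β≤ → no-induced-matching
      (greedy-clique Fin._≟_ ApartEdges blocked b₂ k xs u (All.map length-blocked ts)
                     (λ _ _ y∉ {tx} {ty} → apart-if-unblocked tx ty y∉) β≤)
      where
      ApartEdges : V → V → Set
      ApartEdges x y = ∀ {tx : OnTriangle v x} {ty : OnTriangle v y} →
                       Apart (proj₁ (edge tx)) (proj₁ (edge ty))
      no-induced-matching : Clique ApartEdges k xs → ⊥
      no-induced-matching (clique ys ys⊆ refl aparts) =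
        free _ f-K1K2 (cone-≺ v (proj₁ matching) (proj₂ matching (λ w _ → v ~ w) (λ _ t → v~edge t)))
        where
        matching = copies-≺ edge (All-resp-⊆ ys⊆ ts) aparts

  IsolatedBranch : V → V → Set
  IsolatedBranch h u = h ~ u × 2 ≤ deg G u × ¬ (∃[ y ] h ~ y × u ~ y)

  module Isolated (h : V) where

    other : V → V
    other u = choose (λ t → u ~ t × t ≢ h) u

    other-spec : ∀ {u} → IsolatedBranch h u → u ~ other u × other u ≢ h
    other-spec {u} (_ , 2≤deg , _) = choose-spec u (avoid-h (deg≥2⇒two-neighbours 2≤deg))
      where
      avoid-h : ∃₂ (λ a b → a ≢ b × u ~ a × u ~ b) → ∃ λ t → u ~ t × t ≢ h
      avoid-h (a , b , a≢b , u~a , u~b) with a Fin.≟ h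
      ... | yes refl = b , u~b , a≢b ∘ sym
      ... | no  a≢h  = a , u~a , a≢h

    h≁other : ∀ {u} → IsolatedBranch h u → h ≁ other u
    h≁other iu = ¬~⇒≁ λ h~o → proj₂ (proj₂ iu) (_ , h~o , proj₁ (other-spec iu))

    edge : ∀ {u} → IsolatedBranch h u → K 2 ≺ G
    edge {u} iu = K-≺ {u ∷ other u ∷ []} ((proj₁ (other-spec iu) ∷ []) ∷ [] ∷ [])

    Spread₁ Spread₂ Spread : V → V → Set
    Spread₁ u u′ = u ≢ u′ × ¬ other u ~ other u′
    Spread₂ u u′ = Spread₁ u u′ × ¬ other u ~ u′
    Spread  u u′ = Spread₂ u u′ × ¬ other u′ ~ u

    apart-if-spread : ∀ {u u′} (iu : IsolatedBranch h u) (iu′ : IsolatedBranch h u′) → Spread u u′ →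
                      Apart (proj₁ (edge iu)) (proj₁ (edge iu′))
    apart-if-spread iu iu′ (((u≢u′ , _) , _) , _) zero zero =
      u≢u′ , ¬~⇒≁ λ u~u′ → proj₂ (proj₂ iu) (_ , proj₁ iu′ , u~u′)
    apart-if-spread iu iu′ (_ , ¬o′~u) zero (suc zero) =
      (λ u≡o′ → ≁⇒¬~ (h≁other iu′) (subst (h ~_) u≡o′ (proj₁ iu))) , ≁-sym (¬~⇒≁ ¬o′~u)
    apart-if-spread iu iu′ ((_ , ¬o~u′) , _) (suc zero) zero =
      (λ o≡u′ → ≁⇒¬~ (h≁other iu) (subst (h ~_) (sym o≡u′) (proj₁ iu′))) , ¬~⇒≁ ¬o~u′
    apart-if-spread iu iu′ (((_ , ¬o~o′) , ¬o~u′) , _) (suc zero) (suc zero) =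
      (λ o≡o′ → ¬o~u′ (subst (_~ _) (sym o≡o′) (~-sym (proj₁ (other-spec iu′))))) , ¬~⇒≁ ¬o~o′

    few-other-neighbours : ∀ {u zs} → IsolatedBranch h u → Unique zs → All (IsolatedBranch h) zs →
                           All (other u ~_) zs → length zs < ρ
    few-other-neighbours iu u-zs izs o~ =
      common-neighbours-bound (λ h≡o → proj₂ (other-spec iu) (sym h≡o)) u-zs
        (All.zipWith (λ (iz , o~z) → proj₁ iz , o~z) (izs , o~))

    -- Three Ramsey refinements leave k vertices u whose edges u — other u are pairwise apart: the
    -- vertices other u are pairwise non-adjacent (else K_k), and no other u is adjacent to a later,
    -- resp. an earlier, u′ (else ρ + 1 of them would be common neighbours of h and one other u).
    isolated-bound : ∀ {ys} → Unique ys → All (IsolatedBranch h) ys → length ys < γ₂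
    isolated-bound {ys} u-ys iys = ≰⇒> λ γ₂≤ → no-star (c₃ γ₂≤)
      where
      restrict : ∀ {zs} → zs ⊆ ys → Unique zs × All (IsolatedBranch h) zs
      restrict zs⊆ = AllPairs-resp-⊆ zs⊆ u-ys , All-resp-⊆ zs⊆ iys

      no-other-clique : ¬ Clique (λ u u′ → other u ~ other u′) k ys
      no-other-clique (clique zs _ refl clq) =
        free _ f-K (subst (λ m → K m ≺ G) (length-map other zs) (K-≺ (AllPairs.map⁺ clq)))

      no-forward-star : ∀ {xs} → xs ⊆ ys → ¬ Clique (λ u u′ → other u ~ u′) (suc ρ) xs
      no-forward-star xs⊆ (clique (z ∷ zs) z∷zs⊆ size (o~zs ∷ _))
        with u-z∷zs , iz ∷ izs ← restrict (⊆-trans z∷zs⊆ xs⊆)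
        = <-irrefl (ℕ.suc-injective size) (few-other-neighbours iz (AllPairs.tail u-z∷zs) izs o~zs)

      no-backward-star : ∀ {xs} → xs ⊆ ys → ¬ Clique (λ u u′ → other u′ ~ u) (suc ρ) xs
      no-backward-star xs⊆ (clique ws ws⊆ size ~o) with initLast ws
      no-backward-star xs⊆ (clique .[] _ () _) | []
      no-backward-star xs⊆ (clique .(zs ++ [ z ]) zs∷ʳz⊆ size ~o) | zs ∷ʳ′ z
        with u-zs∷ʳz , izs∷ʳz ← restrict (⊆-trans zs∷ʳz⊆ xs⊆)
        = <-irrefl (ℕ.suc-injective (trans (+-comm 1 (length zs)) (trans (sym (length-++ zs)) size)))
            (few-other-neighbours (All.lookup izs∷ʳz (∈-++⁺ʳ zs (here refl)))
              (AllPairs-resp-⊆ (++⁺ʳ [ z ] ⊆-refl) u-zs∷ʳz) (All.++⁻ˡ zs izs∷ʳz) (AllPairs-∷ʳ⁻ zs ~o))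

      c₁ : γ₂ ≤ length ys → Clique Spread₁ (ramsey (suc ρ) (ramsey (suc ρ) k)) ys
      c₁ γ₂≤ = refine-clique (λ u u′ → other u ~? other u′) (clique ys ⊆-refl refl u-ys) γ₂≤
                             no-other-clique

      c₂ : γ₂ ≤ length ys → Clique Spread₂ (ramsey (suc ρ) k) ys
      c₂ γ₂≤ = refine-clique (λ u u′ → other u ~? u′) (c₁ γ₂≤) ≤-refl
                             (no-forward-star (Clique.sublist (c₁ γ₂≤)))

      c₃ : γ₂ ≤ length ys → Clique Spread k ys
      c₃ γ₂≤ = refine-clique (λ u u′ → other u′ ~? u) (c₂ γ₂≤) ≤-refl
                             (no-backward-star (Clique.sublist (c₂ γ₂≤)))

      no-star : ¬ Clique Spread k ys
      no-star (clique zs zs⊆ refl spread) =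
        free _ f-star (apex-≺ (proj₁ matching) h (proj₁ ∘ from-h)
                        (λ j → trans (proj₂ (from-h j)) (sym (firstOfK2-copyIndex (length zs) j))))
        where
        matching = copies-≺ edge (All-resp-⊆ zs⊆ iys)
                             (AllPairs.map (λ s {iu} {iu′} → apart-if-spread iu iu′ s) spread)
        edge-from-h : ∀ {u} (iu : IsolatedBranch h u) i →
                      proj₁ (edge iu) i ≢ h × adj G h (proj₁ (edge iu) i) ≡ isFirst i
        edge-from-h iu zero       = ≢-sym (~⇒≢ (proj₁ iu)) , proj₁ iu
        edge-from-h iu (suc zero) = proj₂ (other-spec iu) , h≁other iu
        from-h : ∀ j → proj₁ (proj₁ matching) j ≢ h ×
                       adj G h (proj₁ (proj₁ matching) j) ≡ isFirst (copyIndex (length zs) j)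
        from-h = proj₂ matching (λ w i → w ≢ h × adj G h w ≡ isFirst i) (λ _ → edge-from-h)

  branch-neighbours : V → List V
  branch-neighbours h = support (λ u → adj G h u ∧ isBranchᵇ u)

  ∈-branch-neighbours⁺ : ∀ {h u} → h ~ u → 2 ≤ deg G u → u ∈ branch-neighbours h
  ∈-branch-neighbours⁺ h~u 2≤deg = ∈-support⁺ (cong₂ _∧_ h~u (isBranchᵇ⁺ 2≤deg))

  ∈-branch-neighbours⁻ : ∀ {h u} → u ∈ branch-neighbours h → h ~ u × 2 ≤ deg G u
  ∈-branch-neighbours⁻ u∈ with h~u , branch ← ∧≡true⇒ (∈-support⁻ u∈) = h~u , isBranchᵇ⁻ branch

  branch-neighbours-bound : ∀ h → length (branch-neighbours h) < γ
  branch-neighbours-bound h = begin-strict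
    length ys                                          ≡⟨ length-filter-∁ onTriangle? ys ⟨
    length (filter onTriangle? ys) + length isolated-ys <⟨ +-mono-< on-triangle isolated ⟩
    β + γ₂                                              ∎
    where
    open ≤-Reasoning
    ys = branch-neighbours h
    onTriangle? : Relation.Unary.Decidable (OnTriangle h)
    onTriangle? _ = em
    on-triangle : length (filter onTriangle? ys) < β
    on-triangle = Triangles.triangle-bound h (Unique.filter⁺ onTriangle? (support-unique _))
                                             (All.all-filter onTriangle? ys)
    isolated-ys = filter (¬? ∘ onTriangle?) ys
    isolated : length isolated-ys < γ₂
    isolated = Isolated.isolated-bound h (Unique.filter⁺ (¬? ∘ onTriangle?) (support-unique _))
                 (All.tabulate λ u∈ → let u∈ys , ¬t    = ∈-filter⁻ (¬? ∘ onTriangle?) {xs = ys} u∈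
                                          h~u  , 2≤deg = ∈-branch-neighbours⁻ u∈ys
                                      in h~u , 2≤deg , λ common → ¬t (h~u , common))

  step : V → List V
  step y = y ∷ branch-neighbours y

  ball : ℕ → V → List V
  ball zero    x = [ x ]
  ball (suc r) x = concatMap step (ball r x)

  length-ball : ∀ r x → length (ball r x) ≤ γ ^ r
  length-ball zero    x = ≤-refl
  length-ball (suc r) x = begin
    length (ball (suc r) x) ≤⟨ length-concatMap-≤ step {xs = ball r x} (All.tabulate λ _ → step-bound) ⟩
    length (ball r x) * γ   ≤⟨ *-monoˡ-≤ γ (length-ball r x) ⟩
    γ ^ r * γ               ≡⟨ *-comm (γ ^ r) γ ⟩
    γ ^ suc r               ∎
    where
    open ≤-Reasoning
    step-bound : ∀ {y} → length (step y) ≤ γ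
    step-bound = branch-neighbours-bound _

  ∈-ball-3 : ∀ {x a b y} → a ∈ step x → b ∈ step a → y ∈ step b → y ∈ ball 3 x
  ∈-ball-3 a∈ b∈ y∈ =
    ∈-concatMap⁺ step {xs = ball 2 _} (lose (∈-concatMap⁺ step {xs = ball 1 _}
      (lose (∈-concatMap⁺ step {xs = [ _ ]} (lose (here refl) a∈)) b∈)) y∈)

  Near : V → V → Set
  Near x t = t ≡ x ⊎ x ~ t

  near-step : ∀ {x t} → Near x t → 2 ≤ deg G t → t ∈ step x
  near-step (inj₁ refl) _     = here refl
  near-step (inj₂ x~t)  2≤deg = there (∈-branch-neighbours⁺ x~t 2≤deg)

  step-near : ∀ {y t} → 2 ≤ deg G y → Near y t → y ∈ step t
  step-near _     (inj₁ refl) = here refl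
  step-near 2≤deg (inj₂ y~t)  = there (∈-branch-neighbours⁺ (~-sym y~t) 2≤deg)

  leaf-unique : ∀ {t a b} → ¬ 2 ≤ deg G t → t ~ a → t ~ b → a ≡ b
  leaf-unique {a = a} {b} small t~a t~b with a Fin.≟ b
  ... | yes a≡b = a≡b
  ... | no  a≢b = ⊥-elim (small (two-neighbours⇒deg≥2 a≢b t~a t~b))

  leaf-near : ∀ {x t} → 2 ≤ deg G x → Near x t → ¬ 2 ≤ deg G t → t ~ x
  leaf-near 2≤deg (inj₁ refl) small = ⊥-elim (small 2≤deg)
  leaf-near _     (inj₂ x~t)  _     = ~-sym x~t

  -- A vertex of degree < 2 next to two vertices forces them to coincide, so a contact through
  -- such a vertex is a shortcut between vertices of degree ≥ 2.
  touching⇒∈ball-3 : ∀ {x y t t′} → 2 ≤ deg G x → 2 ≤ deg G y → Near x t → Near y t′ →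
                     t ≡ t′ ⊎ t ~ t′ → y ∈ ball 3 x
  touching⇒∈ball-3 {t = t} {t′} dx dy nx ny touching with 2 ≤? deg G t | 2 ≤? deg G t′ | touching
  ... | yes dt | _       | inj₁ refl = ∈-ball-3 (near-step nx dt) (step-near dy ny) (here refl)
  ... | no  st | _       | inj₁ refl with refl ← leaf-unique st (leaf-near dx nx st) (leaf-near dy ny st)
    = ∈-ball-3 (here refl) (here refl) (here refl)
  ... | yes dt | yes dt′ | inj₂ t~t′ =
    ∈-ball-3 (near-step nx dt) (there (∈-branch-neighbours⁺ t~t′ dt′)) (step-near dy ny)
  ... | no  st | _       | inj₂ t~t′ with refl ← leaf-unique st (leaf-near dx nx st) t~t′
    = ∈-ball-3 (here refl) (here refl) (step-near dy ny)
  ... | yes dt | no st′  | inj₂ t~t′ with refl ← leaf-unique st′ (leaf-near dy ny st′) (~-sym t~t′)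
    = ∈-ball-3 (near-step nx dt) (here refl) (here refl)

  Far : V → V → Set
  Far x y = ∀ {t t′} → Near x t → Near y t′ → t ≢ t′ × t ≁ t′

  far-if-∉ball-3 : ∀ {x y} → 2 ≤ deg G x → 2 ≤ deg G y → y ∉ ball 3 x → Far x y
  far-if-∉ball-3 dx dy y∉ nx ny =
    (λ t≡t′ → y∉ (touching⇒∈ball-3 dx dy nx ny (inj₁ t≡t′))) ,
    ¬~⇒≁ (λ t~t′ → y∉ (touching⇒∈ball-3 dx dy nx ny (inj₂ t~t′)))

  far-copies-≺ : {A : Graph} {P : V → Set} (mk : ∀ {x} → P x → A ≺ G) →
                 (∀ {x} (px : P x) i → Near x (proj₁ (mk px) i)) →
                 ∀ {ys} → All P ys → AllPairs Far ys → copies (length ys) A ≺ G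
  far-copies-≺ mk near pys far =
    proj₁ (copies-≺ mk pys (AllPairs.map (λ far-xy {px} {py} i j → far-xy (near px i) (near py j)) far))

  ends : V → V × V
  ends x = choose (λ (a , b) → a ≢ b × x ~ a × x ~ b) (x , x)

  ends-spec : ∀ {x} → 2 ≤ deg G x →
              proj₁ (ends x) ≢ proj₂ (ends x) × x ~ proj₁ (ends x) × x ~ proj₂ (ends x)
  ends-spec {x} 2≤deg with a , b , ab ← deg≥2⇒two-neighbours 2≤deg = choose-spec (x , x) ((a , b) , ab)

  cherry : V → List V
  cherry x = proj₁ (ends x) ∷ x ∷ proj₂ (ends x) ∷ []

  near-cherry : ∀ {x} → 2 ≤ deg G x → ∀ i → Near x (lookup (cherry x) i)
  near-cherry 2≤deg zero             = inj₂ (proj₁ (proj₂ (ends-spec 2≤deg)))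
  near-cherry 2≤deg (suc zero)       = inj₁ refl
  near-cherry 2≤deg (suc (suc zero)) = inj₂ (proj₂ (proj₂ (ends-spec 2≤deg)))

  ClosedCherry OpenCherry : V → Set
  ClosedCherry x = 2 ≤ deg G x × proj₁ (ends x) ~ proj₂ (ends x)
  OpenCherry   x = 2 ≤ deg G x × ¬ proj₁ (ends x) ~ proj₂ (ends x)

  triangle-≺ : ∀ {x} → ClosedCherry x → K 3 ≺ G
  triangle-≺ {x} (2≤deg , a~b) with _ , x~a , x~b ← ends-spec 2≤deg =
    K-≺ {cherry x} ((~-sym x~a ∷ a~b ∷ []) ∷ (x~b ∷ []) ∷ [] ∷ [])

  path-≺ : ∀ {x} → OpenCherry x → P3 ≺ G
  path-≺ (2≤deg , ¬a~b) with a≢b , x~a , x~b ← ends-spec 2≤deg = P3-≺ (~-sym x~a) x~b (¬~⇒≁ ¬a~b) a≢b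

  branch-bound : #deg≥2 G < branchBound
  branch-bound = subst (_< branchBound) (length-support isBranchᵇ) (≰⇒> λ big → no-far-cherries
    (greedy-clique Fin._≟_ Far (ball 3) (γ ^ 3) (k + k) D (support-unique _)
       (All.tabulate λ _ → length-ball 3 _) (λ x∈ y∈ y∉ → far-if-∉ball-3 (branch x∈) (branch y∈) y∉) big))
    where
    D = support isBranchᵇ
    branch : ∀ {x} → x ∈ D → 2 ≤ deg G x
    branch = isBranchᵇ⁻ ∘ ∈-support⁻
    branches : ∀ {Q : V → Set} {ys} → ys ⊆ D → All Q ys → All (λ x → 2 ≤ deg G x × Q x) ys
    branches ys⊆ Qs = All.zip (All-resp-⊆ ys⊆ (All.tabulate branch) , Qs)
    no-far-cherries : Clique Far (k + k) D → ⊥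
    no-far-cherries (clique xs xs⊆ size far)
      with majority (λ x → proj₁ (ends x) ~? proj₂ (ends x)) k xs (≤-reflexive (sym size))
    ... | inj₁ (ys , ys⊆ , refl , closed) =
      free _ f-K3 (far-copies-≺ triangle-≺ (near-cherry ∘ proj₁) (branches (⊆-trans ys⊆ xs⊆) closed)
                                (AllPairs-resp-⊆ ys⊆ far))
    ... | inj₂ (ys , ys⊆ , refl , open′) =
      free _ f-P3 (far-copies-≺ path-≺ (near-cherry ∘ proj₁) (branches (⊆-trans ys⊆ xs⊆) open′)
                                (AllPairs-resp-⊆ ys⊆ far))

-- Vertices of degree ≥ 2 in the seven graphs

open Adjacency using (two-neighbours⇒deg≥2; deg≥2⇒two-neighbours)

Branches : Graph → ℕ → Set
Branches F m = Σ (List (Fin (n F))) λ xs → length xs ≡ m × Unique xs × All (λ x → 2 ≤ deg F x) xs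

Branches⇒≤#deg≥2 : ∀ {F m} → Branches F m → m ≤ #deg≥2 F
Branches⇒≤#deg≥2 {F} (_ , refl , u , branches) =
  unique-length-≤-countᵇ u (All.map (Adjacency.isBranchᵇ⁺ F) branches)

module _ (t : Bool) (A B : Graph) where

  private
    A+B = combine t A B

  adj-↑ˡ : ∀ i j → adj A+B (i ↑ˡ n B) (j ↑ˡ n B) ≡ adj A i j
  adj-↑ˡ i j rewrite splitAt-↑ˡ (n A) i (n B) | splitAt-↑ˡ (n A) j (n B) = refl

  adj-↑ʳ : ∀ i j → adj A+B (n A ↑ʳ i) (n A ↑ʳ j) ≡ adj B i j
  adj-↑ʳ i j rewrite splitAt-↑ʳ (n A) (n B) i | splitAt-↑ʳ (n A) (n B) j = refl

  adj-↑ʳ↑ˡ : ∀ i j → adj A+B (n A ↑ʳ i) (j ↑ˡ n B) ≡ t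
  adj-↑ʳ↑ˡ i j rewrite splitAt-↑ʳ (n A) (n B) i | splitAt-↑ˡ (n A) j (n B) = refl

  ↑ˡ≢↑ʳ : ∀ i j → i ↑ˡ n B ≢ n A ↑ʳ j
  ↑ˡ≢↑ʳ i j eq with trans (sym (splitAt-↑ˡ (n A) i (n B)))
                          (trans (cong (splitAt (n A)) eq) (splitAt-↑ʳ (n A) (n B) j))
  ... | ()

  ↑ˡ-branch : ∀ {i} → 2 ≤ deg A i → 2 ≤ deg A+B (i ↑ˡ n B)
  ↑ˡ-branch {i} 2≤deg with a , b , a≢b , i~a , i~b ← deg≥2⇒two-neighbours A 2≤deg =
    two-neighbours⇒deg≥2 A+B (a≢b ∘ ↑ˡ-injective (n B) a b)
                             (trans (adj-↑ˡ i a) i~a) (trans (adj-↑ˡ i b) i~b)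

  ↑ʳ-branch : ∀ {i} → 2 ≤ deg B i → 2 ≤ deg A+B (n A ↑ʳ i)
  ↑ʳ-branch {i} 2≤deg with a , b , a≢b , i~a , i~b ← deg≥2⇒two-neighbours B 2≤deg =
    two-neighbours⇒deg≥2 A+B (a≢b ∘ ↑ʳ-injective (n A) a b)
                             (trans (adj-↑ʳ i a) i~a) (trans (adj-↑ʳ i b) i~b)

copies-branches : ∀ {X x} → 2 ≤ deg X x → ∀ k → Branches (copies k X) k
copies-branches         x-branch zero    = [] , refl , [] , []
copies-branches {X} {x} x-branch (suc k) with xs , length≡k , u , branches ← copies-branches x-branch k =
  (x ↑ˡ _) ∷ map (n X ↑ʳ_) xs ,
  cong suc (trans (length-map _ xs) length≡k) ,
  All.map⁺ (All.tabulate λ {j} _ → ↑ˡ≢↑ʳ false X (copies k X) x j) ∷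
    Unique.map⁺ (↑ʳ-injective (n X) _ _) u ,
  ↑ˡ-branch false X (copies k X) x-branch ∷ All.map⁺ (All.map (↑ʳ-branch false X (copies k X)) branches)

join-branches : ∀ (A : Graph) {a a′} → a ≢ a′ → ∀ m → Branches (A ⊞ E m) m
join-branches A {a} {a′} a≢a′ m =
  map (n A ↑ʳ_) (allFin m) ,
  trans (length-map _ (allFin m)) (length-tabulate _) ,
  Unique.map⁺ (↑ʳ-injective (n A) _ _) (Unique.allFin⁺ m) ,
  All.map⁺ (All.tabulate λ {j} _ → two-neighbours⇒deg≥2 (A ⊞ E m) (a≢a′ ∘ ↑ˡ-injective m a a′)
                                     (adj-↑ʳ↑ˡ true A (E m) j a) (adj-↑ʳ↑ˡ true A (E m) j a′))

K-branch : ∀ c i → 2 ≤ deg (K (3 + c)) i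
K-branch c zero          = two-neighbours⇒deg≥2 (K (3 + c)) {zero}        {suc zero} {suc (suc zero)}
                             (λ ()) refl refl
K-branch c (suc zero)    = two-neighbours⇒deg≥2 (K (3 + c)) {suc zero}    {zero}     {suc (suc zero)}
                             (λ ()) refl refl
K-branch c (suc (suc i)) = two-neighbours⇒deg≥2 (K (3 + c)) {suc (suc i)} {zero}     {suc zero}
                             (λ ()) refl refl

K-branches : ∀ c → Branches (K (3 + c)) (3 + c)
K-branches c =
  allFin (3 + c) , length-tabulate id , Unique.allFin⁺ (3 + c) , All.tabulate λ {i} _ → K-branch c i

P3-branch : 2 ≤ deg P3 (suc zero)
P3-branch = two-neighbours⇒deg≥2 P3 {suc zero} {zero} {suc (suc zero)} (λ ()) refl refl

matched-firsts : ∀ m → Σ (List (Fin (n (copies m (K 2))))) λ ps → length ps ≡ m × Unique ps ×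
                 All (λ p → firstOfK2 m p ≡ true × ∃ λ q → adj (copies m (K 2)) p q ≡ true) ps
matched-firsts zero    = [] , refl , [] , []
matched-firsts (suc m) with ps , length≡m , u , firsts ← matched-firsts m =
  zero ∷ map (λ p → suc (suc p)) ps ,
  cong suc (trans (length-map _ ps) length≡m) ,
  All.map⁺ (All.tabulate λ _ ()) ∷ Unique.map⁺ (suc-injective ∘ suc-injective) u ,
  (refl , suc zero , refl) ∷ All.map⁺ (All.map (λ (first , q , p~q) → first , suc (suc q) , p~q) firsts)

K1star-branches : ∀ m → Branches (K1star m) m
K1star-branches m with ps , length≡m , u , firsts ← matched-firsts m =
  map suc ps , trans (length-map _ ps) length≡m , Unique.map⁺ suc-injective u ,
  All.map⁺ (All.map (λ {p} (first , q , p~q) →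
                       two-neighbours⇒deg≥2 (K1star m) {suc p} {zero} {suc q} (λ ()) first p~q)
                    firsts)

fan-branches : ∀ m → Branches (K 1 ⊞ copies m (K 2)) m
fan-branches m with ps , length≡m , u , firsts ← matched-firsts m =
  map suc ps , trans (length-map _ ps) length≡m , Unique.map⁺ suc-injective u ,
  All.map⁺ (All.map (λ {p} (_ , q , p~q) →
                       two-neighbours⇒deg≥2 (K 1 ⊞ copies m (K 2)) {suc p} {zero} {suc q} (λ ()) refl p~q)
                    firsts)

-- With 3 + c rather than c, also the vertices of K_k have degree ≥ 2.
Forb-branches : ∀ c {F} → Forb (3 + c) F → Branches F (3 + c)
Forb-branches c f-K    = K-branches c
Forb-branches c f-P3   = copies-branches {x = suc zero} P3-branch _
Forb-branches c f-K3   = copies-branches {x = zero} (K-branch 0 zero) _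
Forb-branches c f-star = K1star-branches _
Forb-branches c f-K2k  = join-branches (E 2) {zero} {suc zero} (λ ()) _
Forb-branches c f-K2E  = join-branches (K 2) {zero} {suc zero} (λ ()) _
Forb-branches c f-K1K2 = fan-branches _

Free-≤F : ∀ {ℋ₁ ℋ₂ G} → ℋ₁ ≤F ℋ₂ → Free ℋ₁ G → Free ℋ₂ G
Free-≤F {G = G} ℋ₁≤ℋ₂ free F F∈ℋ₂ F≺G with H , H∈ℋ₁ , H≺F ← ℋ₁≤ℋ₂ F F∈ℋ₂ =
  free H H∈ℋ₁ (≺-trans {H} {F} {G} H≺F F≺G)

bounded⇒≤F-Forb : ExcludedMiddle 0ℓ → (ℋ : Family) →
                  (∃ λ c → ∀ G → Free ℋ G → #deg≥2 G < c) → ∃ λ k → 1 ≤ k × (ℋ ≤F Forb k)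
bounded⇒≤F-Forb em ℋ (c , bounded) =
  3 + c , s≤s z≤n , λ F F∈Forb → not-ℋ-free F (Branches⇒≤#deg≥2 {F} (Forb-branches c F∈Forb))
  where
  not-ℋ-free : ∀ F → 3 + c ≤ #deg≥2 F → ∃ λ H → ℋ H × (H ≺ F)
  not-ℋ-free F many with em {∃ λ H → ℋ H × (H ≺ F)}
  ... | yes H≺F    = H≺F
  ... | no  ∄H     = ⊥-elim (<⇒≱ (bounded F λ H H∈ℋ H≺F → ∄H (H , H∈ℋ , H≺F)) (≤-trans (m≤n+m c 3) many))

≤F-Forb⇒bounded : ExcludedMiddle 0ℓ → (ℋ : Family) →
                  (∃ λ k → 1 ≤ k × (ℋ ≤F Forb k)) → ∃ λ c → ∀ G → Free ℋ G → #deg≥2 G < c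
≤F-Forb⇒bounded em ℋ (k , _ , ℋ≤Forb) =
  Bounds.branchBound k , λ G free → ForbFree.branch-bound em k G (Free-≤F {G = G} ℋ≤Forb free)

corollary1p10 : ExcludedMiddle 0ℓ → (ℋ : Family) →
    ((∃ λ (c : ℕ) → ∀ (G : Graph) → Free ℋ G → #deg≥2 G < c)
      → (∃ λ (k : ℕ) → 1 ≤ k × (ℋ ≤F Forb k)))
    × ((∃ λ (k : ℕ) → 1 ≤ k × (ℋ ≤F Forb k))
      → (∃ λ (c : ℕ) → ∀ (G : Graph) → Free ℋ G → #deg≥2 G < c))
corollary1p10 em ℋ = bounded⇒≤F-Forb em ℋ , ≤F-Forb⇒bounded em ℋ
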